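{- Let $G$ be a stitched $2$-ichromatic ordered graph whose two parts (in its interval $2$-coloring) have sizes $m$ and $n$. Then $R(G) \geq 4r+1$, where $r = \min(m,n)-1$.
   Context: An ordered graph is a graph together with a linear ordering of its vertices. An ordered graph $H$ is contained in an ordered graph $H'$ if there is an order-preserving injection $V(H)\to V(H')$ mapping edges to edges. An interval coloring of an ordered graph is a partition of its vertex set into independent sets each consisting of consecutive vertices (these sets are called parts); the interval chromatic number is the minimum number of parts in an interval coloring, and an ordered graph is $k$-ichromatic if its interval chromatic number is $k$. A $k$-ichromatic ordered graph is stitched if the set of size $2k$ consisting of the first and last vertices of each part of the interval $k$-coloring lies in a single connected component of the graph (for a stitched $2$-ichromatic ordered graph the interval $2$-coloring is unique). The (2-color) Ramsey number $R(G)$ of an ordered graph $G$ is the minimum $N$ such that every coloring of the edges of the ordered complete graph on $N$ vertices with 2 colors contains a monochromatic copy of $G$ (containment in the ordered sense). -}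

module Defs where

open import Data.Nat using (ℕ; zero; suc; _+_; _∸_; _≤_; _<_; _⊓_)
open import Data.Fin using (Fin; toℕ)
open import Data.Bool using (Bool)
open import Data.Product using (Σ; ∃; ∃-syntax; _×_; _,_)
open import Data.Sum using (_⊎_)
open import Data.Empty using (⊥)
open import Relation.Binary.PropositionalEquality using (_≡_)

-- An ordered graph on k vertices: vertex set Fin k with its natural order,
-- and a symmetric irreflexive adjacency relation.
record OrderedGraph (k : ℕ) : Set₁ where
  field
    E     : Fin k → Fin k → Set
    sym   : ∀ {u v} → E u v → E v u
    irrefl : ∀ {u} → E u u → ⊥
open OrderedGraph public

data Reach {k : ℕ} (G : OrderedGraph k) : Fin k → Fin k → Set where
  here : ∀ {u} → Reach G u u
  step : ∀ {u w v} → E G u w → Reach G w v → Reach G u v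

-- The two-interval partition of Fin (m + n): first part = first m vertices,
-- second part = last n vertices.  It is an interval 2-coloring iff both
-- parts are independent sets.
IntervalTwoColoring : (m n : ℕ) → OrderedGraph (m + n) → Set
IntervalTwoColoring m n G =
  1 ≤ m × 1 ≤ n ×
  (∀ u v → E G u v → toℕ u < m → toℕ v < m → ⊥) ×
  (∀ u v → E G u v → m ≤ toℕ u → m ≤ toℕ v → ⊥)

-- G is 2-ichromatic with the interval 2-coloring of part sizes m and n:
-- that partition is an interval coloring, and G is not 1-ichromatic
-- (i.e. G has an edge).
TwoIchromatic : (m n : ℕ) → OrderedGraph (m + n) → Set
TwoIchromatic m n G = IntervalTwoColoring m n G × (∃[ u ] ∃[ v ] E G u v)

Endpoint : (m n : ℕ) → Fin (m + n) → Set
Endpoint m n v =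
  toℕ v ≡ 0 ⊎ toℕ v ≡ m ∸ 1 ⊎ toℕ v ≡ m ⊎ toℕ v ≡ m + n ∸ 1

Stitched : (m n : ℕ) → OrderedGraph (m + n) → Set
Stitched m n G = ∀ u v → Endpoint m n u → Endpoint m n v → Reach G u v

-- A 2-coloring of the edges of the ordered complete graph on N vertices;
-- only the values c i j with i < j are used (edge {i,j}, i<j).
EdgeColoring : ℕ → Set
EdgeColoring N = Fin N → Fin N → Bool

MonoCopy : ∀ {k} (G : OrderedGraph k) {N : ℕ} → EdgeColoring N → Bool → Set
MonoCopy {k} G {N} c b =
  Σ (Fin k → Fin N) λ f →
    (∀ i j → toℕ i < toℕ j → toℕ (f i) < toℕ (f j)) ×
    (∀ i j → toℕ i < toℕ j → E G i j → c (f i) (f j) ≡ b)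

Arrows : ℕ → ∀ {k} → OrderedGraph k → Set
Arrows N G = (c : EdgeColoring N) → ∃[ b ] MonoCopy G c b

-- R(G) ≥ K  iff  every N with N → G satisfies K ≤ N (R(G) is the least such N)
RamseyAtLeast : ∀ {k} → OrderedGraph k → ℕ → Set
RamseyAtLeast G K = ∀ N → Arrows N G → K ≤ N

-- Split the vertices of K_N, N ≤ 4r, into four consecutive blocks of r vertices and colour
-- an edge red exactly when one of its ends lies in an outer (first or last) block.  In a
-- monochromatic copy of G, the outer-indicator of the block of each vertex, flipped on the
-- first part when the copy is red, is constant along edges, hence on the component of the
-- endpoints of the parts.  So both ends of each part lie on the same side; as a part has
-- at least r + 1 vertices its ends lie in distinct blocks, and the only same-side pairs of
-- distinct blocks, {0,3} and {1,2}, both straddle the middle, so the two parts of G cannot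
-- be placed one after the other.
module Submission where

open import Defs hiding (sym)
open import Data.Bool using (Bool; true; false; _∧_; _xor_)
open import Data.Empty using (⊥; ⊥-elim)
open import Data.Fin using (Fin; zero; toℕ; fromℕ<)
open import Data.Fin.Properties using (toℕ<n; toℕ-fromℕ<; toℕ-injective)
open import Data.Nat
  using (ℕ; zero; suc; _+_; _*_; _∸_; _⊓_; _≤_; _<_; z≤n; s≤s; NonZero; _/_; _<?_)
open import Data.Nat.DivMod using (/-monoˡ-≤; m/n≡1+[m∸n]/n; m<n*o⇒m/o<n)
open import Data.Nat.Properties
open import Data.Product using (_×_; _,_; proj₁; proj₂)
open import Data.Sum using (inj₁; inj₂)
open import Relation.Binary.Definitions using (tri<; tri≈; tri>)
open import Relation.Binary.PropositionalEquality
open import Relation.Nullary using (¬_; does; yes; no)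
open import Relation.Nullary.Decidable using (dec-true; dec-false)

xor-cancelˡ : ∀ x {y z} → x xor y ≡ x xor z → y ≡ z
xor-cancelˡ false eq = eq
xor-cancelˡ true {false} {false} eq = refl
xor-cancelˡ true {true} {true} eq = refl

xor-transpose : ∀ x y {z} → x xor y ≡ z → z xor x ≡ y
xor-transpose false false refl = refl
xor-transpose false true refl = refl
xor-transpose true false refl = refl
xor-transpose true true refl = refl

Reach-preserves : ∀ {k} (G : OrderedGraph k) {A : Set} (L : Fin k → A) →
  (∀ u w → E G u w → L u ≡ L w) → ∀ {u v} → Reach G u v → L u ≡ L v
Reach-preserves G L pres here = refl
Reach-preserves G L pres (step e r) = trans (pres _ _ e) (Reach-preserves G L pres r)

edge-crosses : ∀ {m n} (G : OrderedGraph (m + n)) → IntervalTwoColoring m n G →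
  ∀ {u w} → toℕ u < toℕ w → E G u w → toℕ u < m × m ≤ toℕ w
edge-crosses {m} G (_ , _ , first-indep , second-indep) {u} {w} u<w e
  with toℕ u <? m | toℕ w <? m
... | no u≮m | _ =
  ⊥-elim (second-indep u w e (≮⇒≥ u≮m) (≤-trans (≮⇒≥ u≮m) (<⇒≤ u<w)))
... | yes u<m | yes w<m = ⊥-elim (first-indep u w e u<m w<m)
... | yes u<m | no w≮m = u<m , ≮⇒≥ w≮m

StrictlyIncreasing : ∀ {K N} → (Fin K → Fin N) → Set
StrictlyIncreasing f = ∀ i j → toℕ i < toℕ j → toℕ (f i) < toℕ (f j)

module _ {K N} {f : Fin K → Fin N} (increasing : StrictlyIncreasing f) where

  increasing⇒monotone : ∀ {i j} → toℕ i ≤ toℕ j → toℕ (f i) ≤ toℕ (f j)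
  increasing⇒monotone {i} {j} i≤j with m≤n⇒m<n∨m≡n i≤j
  ... | inj₁ i<j = <⇒≤ (increasing i j i<j)
  ... | inj₂ i≡j = ≤-reflexive (cong (λ v → toℕ (f v)) (toℕ-injective i≡j))

  increasing-spreads : ∀ k {i j} → toℕ i + k ≤ toℕ j → toℕ (f i) + k ≤ toℕ (f j)
  increasing-spreads zero {i} {j} i≤j =
    subst (_≤ toℕ (f j)) (sym (+-identityʳ _))
      (increasing⇒monotone (subst (_≤ toℕ j) (+-identityʳ _) i≤j))
  increasing-spreads (suc k) {i} {j} i+k<j = begin
      toℕ (f i) + suc k  ≡⟨ +-suc (toℕ (f i)) k ⟩
      suc (toℕ (f i) + k) ≤⟨ s≤s (increasing-spreads k (≤-reflexive (sym w≡i+k))) ⟩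
      suc (toℕ (f w))    ≤⟨ increasing w j (subst (_< toℕ j) (sym w≡i+k) i+k<j′) ⟩
      toℕ (f j)          ∎
    where
    open ≤-Reasoning
    i+k<j′ : toℕ i + k < toℕ j
    i+k<j′ = subst (_≤ toℕ j) (+-suc (toℕ i) k) i+k<j
    w : Fin K
    w = fromℕ< (<-≤-trans i+k<j′ (<⇒≤ (toℕ<n j)))
    w≡i+k : toℕ w ≡ toℕ i + k
    w≡i+k = toℕ-fromℕ< _

isOuter : ℕ → Bool
isOuter 0 = true
isOuter 3 = true
isOuter _ = false

isOuter-pair-straddles : ∀ {a b} → a < b → b < 4 → isOuter a ≡ isOuter b → a < 2 × 2 ≤ b
isOuter-pair-straddles {0} {1} _ _ ()
isOuter-pair-straddles {0} {suc (suc _)} _ _ _ = s≤s z≤n , s≤s (s≤s z≤n)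
isOuter-pair-straddles {1} {suc (suc _)} _ _ _ = s≤s (s≤s z≤n) , s≤s (s≤s z≤n)
isOuter-pair-straddles {1} {1} (s≤s ()) _ _
isOuter-pair-straddles {2} {1} (s≤s ()) _ _
isOuter-pair-straddles {2} {2} (s≤s (s≤s ())) _ _
isOuter-pair-straddles {2} {3} _ _ ()
isOuter-pair-straddles {2} {suc (suc (suc (suc _)))} _ (s≤s (s≤s (s≤s (s≤s ())))) _
isOuter-pair-straddles {suc (suc (suc _))} (s≤s (s≤s (s≤s ()))) (s≤s (s≤s (s≤s (s≤s z≤n)))) _

isOuter-pairs-nested : ∀ {a b c d} → a < b → b ≤ c → c < d → d < 4 →
  isOuter a ≡ isOuter b → isOuter c ≡ isOuter d → ⊥
isOuter-pairs-nested {b = b} {c} a<b b≤c c<d d<4 ab cd =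
  <-irrefl refl (≤-<-trans (≤-trans 2≤b b≤c) c<2)
  where
  2≤b : 2 ≤ b
  2≤b = proj₂ (isOuter-pair-straddles a<b (≤-<-trans b≤c (<-trans c<d d<4)) ab)
  c<2 : c < 2
  c<2 = proj₁ (isOuter-pair-straddles c<d d<4 cd)

module Blocks (r : ℕ) .{{_ : NonZero r}} where

  block : ℕ → ℕ
  block x = x / r

  block-mono : ∀ {x y} → x ≤ y → block x ≤ block y
  block-mono = /-monoˡ-≤ r

  block-<-apart : ∀ {x y} → x + r ≤ y → block x < block y
  block-<-apart {x} {y} x+r≤y = begin-strict
      x / r            ≤⟨ /-monoˡ-≤ r (m+n≤o⇒m≤o∸n x x+r≤y) ⟩
      (y ∸ r) / r      <⟨ n<1+n _ ⟩
      1 + (y ∸ r) / r  ≡⟨ m/n≡1+[m∸n]/n (m+n≤o⇒n≤o x x+r≤y) ⟨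
      y / r            ∎
    where open ≤-Reasoning

  block<4 : ∀ {x} → x < 4 * r → block x < 4
  block<4 = m<n*o⇒m/o<n

  blockColouring : ∀ {N} → EdgeColoring N
  blockColouring x y = isOuter (block (toℕ x)) xor isOuter (block (toℕ y))

module Endpoints (m′ n′ : ℕ) where

  Vertex : Set
  Vertex = Fin (suc m′ + suc n′)

  first₁ first₂ last₁ last₂ : Vertex
  first₁ = zero
  last₁ = fromℕ< (s≤s (m≤m+n m′ (suc n′)))
  first₂ = fromℕ< (s≤s (m<m+n m′ (s≤s z≤n)))
  last₂ = fromℕ< {m′ + suc n′} ≤-refl

  toℕ-last₁ : toℕ last₁ ≡ m′
  toℕ-last₁ = toℕ-fromℕ< (s≤s (m≤m+n m′ (suc n′)))

  toℕ-first₂ : toℕ first₂ ≡ suc m′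
  toℕ-first₂ = toℕ-fromℕ< (s≤s (m<m+n m′ (s≤s z≤n)))

  toℕ-last₂ : toℕ last₂ ≡ m′ + suc n′
  toℕ-last₂ = toℕ-fromℕ< {m′ + suc n′} ≤-refl

  first₁+r≤last₁ : ∀ {r} → r ≤ m′ → toℕ first₁ + r ≤ toℕ last₁
  first₁+r≤last₁ r≤m′ = subst (_ ≤_) (sym toℕ-last₁) r≤m′

  last₁≤first₂ : toℕ last₁ ≤ toℕ first₂
  last₁≤first₂ = subst₂ _≤_ (sym toℕ-last₁) (sym toℕ-first₂) (n≤1+n m′)

  first₂+r≤last₂ : ∀ {r} → r ≤ n′ → toℕ first₂ + r ≤ toℕ last₂
  first₂+r≤last₂ {r} r≤n′ = subst₂ (λ x y → x + r ≤ y) (sym toℕ-first₂) (sym toℕ-last₂)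
    (≤-trans (+-monoʳ-≤ (suc m′) r≤n′) (≤-reflexive (sym (+-suc m′ n′))))

  first₁-endpoint : Endpoint (suc m′) (suc n′) first₁
  first₁-endpoint = inj₁ refl

  last₁-endpoint : Endpoint (suc m′) (suc n′) last₁
  last₁-endpoint = inj₂ (inj₁ toℕ-last₁)

  first₂-endpoint : Endpoint (suc m′) (suc n′) first₂
  first₂-endpoint = inj₂ (inj₂ (inj₁ toℕ-first₂))

  last₂-endpoint : Endpoint (suc m′) (suc n′) last₂
  last₂-endpoint = inj₂ (inj₂ (inj₂ toℕ-last₂))

  first₁∈first : toℕ first₁ < suc m′
  first₁∈first = s≤s z≤n

  last₁∈first : toℕ last₁ < suc m′
  last₁∈first = s≤s (≤-reflexive toℕ-last₁)

  first₂∈second : suc m′ ≤ toℕ first₂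
  first₂∈second = ≤-reflexive (sym toℕ-first₂)

  last₂∈second : suc m′ ≤ toℕ last₂
  last₂∈second = ≤-trans first₂∈second (m+n≤o⇒m≤o (toℕ first₂) (first₂+r≤last₂ z≤n))

module _ {m′ n′} (G : OrderedGraph (suc m′ + suc n′))
  (parts : IntervalTwoColoring (suc m′) (suc n′) G) (stitched : Stitched (suc m′) (suc n′) G)
  (r : ℕ) .{{_ : NonZero r}} {N} (b : Bool) (f : Fin (suc m′ + suc n′) → Fin N)
  (coloured : ∀ i j → toℕ i < toℕ j → E G i j → Blocks.blockColouring r (f i) (f j) ≡ b) where

  open Blocks r
  open Endpoints m′ n′

  side : Vertex → Bool
  side v = isOuter (block (toℕ (f v)))

  private
    m : ℕ
    m = suc m′

    label : Vertex → Bool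
    label v = (does (toℕ v <? m) ∧ b) xor side v

    label-first : ∀ v → toℕ v < m → label v ≡ b xor side v
    label-first v v<m rewrite dec-true (toℕ v <? m) v<m = refl

    label-second : ∀ v → m ≤ toℕ v → label v ≡ side v
    label-second v m≤v rewrite dec-false (toℕ v <? m) (≤⇒≯ m≤v) = refl

    label-edge< : ∀ {u w} → toℕ u < toℕ w → E G u w → label u ≡ label w
    label-edge< {u} {w} u<w e with edge-crosses G parts u<w e
    ... | u<m , m≤w = begin
        label u        ≡⟨ label-first u u<m ⟩
        b xor side u   ≡⟨ xor-transpose (side u) (side w) (coloured u w u<w e) ⟩
        side w         ≡⟨ label-second w m≤w ⟨
        label w        ∎
      where open ≡-Reasoning

    label-edge : ∀ u w → E G u w → label u ≡ label w
    label-edge u w e with <-cmp (toℕ u) (toℕ w)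
    ... | tri< u<w _ _ = label-edge< u<w e
    ... | tri≈ _ u≡w _ = ⊥-elim (irrefl G (subst (E G u) (sym (toℕ-injective u≡w)) e))
    ... | tri> _ _ w<u = sym (label-edge< w<u (OrderedGraph.sym G e))

    endpoints-same-label : ∀ u v → Endpoint m (suc n′) u → Endpoint m (suc n′) v →
      label u ≡ label v
    endpoints-same-label u v eu ev = Reach-preserves G label label-edge (stitched u v eu ev)

  first-part-ends-same-side : side first₁ ≡ side last₁
  first-part-ends-same-side = xor-cancelˡ b (begin
      b xor side first₁  ≡⟨ label-first first₁ first₁∈first ⟨
      label first₁       ≡⟨ endpoints-same-label first₁ last₁ first₁-endpoint last₁-endpoint ⟩
      label last₁        ≡⟨ label-first last₁ last₁∈first ⟩
      b xor side last₁   ∎)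
    where open ≡-Reasoning

  second-part-ends-same-side : side first₂ ≡ side last₂
  second-part-ends-same-side = begin
      side first₂   ≡⟨ label-second first₂ first₂∈second ⟨
      label first₂  ≡⟨ endpoints-same-label first₂ last₂ first₂-endpoint last₂-endpoint ⟩
      label last₂   ≡⟨ label-second last₂ last₂∈second ⟩
      side last₂    ∎
    where open ≡-Reasoning

blockColouring-avoids : ∀ {m′ n′} (G : OrderedGraph (suc m′ + suc n′)) →
  IntervalTwoColoring (suc m′) (suc n′) G → Stitched (suc m′) (suc n′) G →
  ∀ r .{{_ : NonZero r}} → r ≤ m′ → r ≤ n′ → ∀ {N} → N ≤ 4 * r →
  ∀ b → ¬ MonoCopy G (Blocks.blockColouring r {N}) b
blockColouring-avoids {m′} {n′} G parts stitched r r≤m′ r≤n′ N≤4r b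
  (f , increasing , coloured) =
  isOuter-pairs-nested
    (block-<-apart (increasing-spreads increasing r (first₁+r≤last₁ r≤m′)))
    (block-mono (increasing⇒monotone increasing last₁≤first₂))
    (block-<-apart (increasing-spreads increasing r (first₂+r≤last₂ r≤n′)))
    (block<4 (<-≤-trans (toℕ<n (f last₂)) N≤4r))
    (first-part-ends-same-side G parts stitched r b f coloured)
    (second-part-ends-same-side G parts stitched r b f coloured)
  where
  open Blocks r
  open Endpoints m′ n′

Arrows⇒nonempty : ∀ {N k} {G : OrderedGraph k} → Arrows N G → Fin k → 0 < N
Arrows⇒nonempty arrows v with arrows (λ _ _ → true)
... | _ , f , _ = ≤-<-trans z≤n (toℕ<n (f v))

theorem1 : (m n : ℕ) (G : OrderedGraph (m + n)) →
    TwoIchromatic m n G → Stitched m n G →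
    RamseyAtLeast G (4 * ((m ⊓ n) ∸ 1) + 1)
theorem1 (suc m′) (suc n′) G (parts , _) stitched N arrows
  with m′ ⊓ n′ | m⊓n≤m m′ n′ | m⊓n≤n m′ n′
... | zero | _ | _ = Arrows⇒nonempty {G = G} arrows zero
... | r@(suc _) | r≤m′ | r≤n′ = ≮⇒≥ λ N<4r+1 →
  let N≤4r = m<1+n⇒m≤n (subst (N <_) (+-comm (4 * r) 1) N<4r+1)
      b , copy = arrows (Blocks.blockColouring r)
  in blockColouring-avoids G parts stitched r r≤m′ r≤n′ N≤4r b copy
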